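{- Let $r \ge 1$ be an integer and let $G$ be a graph of order $n$ with independence number $\alpha(G) = \alpha$. Then (a) $\Gamma_{d,r}(K_n) \le r \log(n+1)$, and (b) $\Gamma_{d,r}(G) \le r\alpha\left(1 + 2\ln(n/\alpha)\right)$.
   Context: $\log$ is base $2$, $\ln$ is natural logarithm. For a digraph $D$ and integer $r \ge 1$, a directed $r$-dominating set is a set $S \subseteq V(D)$ such that every vertex $u \notin S$ has at least $r$ vertices $v \in S$ with arc $(v,u)$; $\gamma_r(D)$ is the minimum size of such a set. For a graph $G$, $\Gamma_{d,r}(G) = \max\{\gamma_r(D) : D \text{ an orientation of } G\}$. -}

module Defs where

open import Data.Nat using (ℕ; zero; suc; _+_; _*_; _^_; _≤_; _!)
open import Data.Bool using (Bool; true; false; not)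
open import Data.Fin using (Fin; _≟_)
open import Data.Fin.Subset using (Subset; _∈_; _∉_; _∩_; ∣_∣)
open import Data.Vec using (tabulate)
open import Data.Product using (Σ; _×_)
open import Data.Sum using (_⊎_)
open import Relation.Nullary.Decidable using (⌊_⌋)
open import Relation.Binary.PropositionalEquality using (_≡_)

record Graph (n : ℕ) : Set where
  field
    adj   : Fin n → Fin n → Bool
    sym   : ∀ u v → adj u v ≡ adj v u
    irrefl : ∀ u → adj u u ≡ false
open Graph public

Kₙ-adj : (n : ℕ) → Fin n → Fin n → Bool
Kₙ-adj n u v = not ⌊ u ≟ v ⌋

-- A digraph on Fin n: arc (v , u) present iff arc v u ≡ true.
Digraph : ℕ → Set
Digraph n = Fin n → Fin n → Bool

IsOrientation : {n : ℕ} → (Fin n → Fin n → Bool) → Digraph n → Set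
IsOrientation {n} E D =
  (∀ u v → D u v ≡ true → E u v ≡ true) ×
  (∀ u v → D u v ≡ true → D v u ≡ false) ×
  (∀ u v → E u v ≡ true → (D u v ≡ true ⊎ D v u ≡ true))

inNbr : {n : ℕ} → Digraph n → Fin n → Subset n
inNbr D u = tabulate (λ v → D v u)

IsRDom : {n : ℕ} → ℕ → Digraph n → Subset n → Set
IsRDom r D S = ∀ u → u ∉ S → r ≤ ∣ S ∩ inNbr D u ∣

IsGammaR : {n : ℕ} → ℕ → Digraph n → ℕ → Set
IsGammaR r D k =
  Σ (Subset _) (λ S → IsRDom r D S × ∣ S ∣ ≡ k) ×
  (∀ S → IsRDom r D S → k ≤ ∣ S ∣)

IsIndependent : {n : ℕ} → Graph n → Subset n → Set
IsIndependent G S = ∀ u v → u ∈ S → v ∈ S → adj G u v ≡ false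

IsIndepNum : {n : ℕ} → Graph n → ℕ → Set
IsIndepNum G a =
  Σ (Subset _) (λ S → IsIndependent G S × ∣ S ∣ ≡ a) ×
  (∀ S → IsIndependent G S → ∣ S ∣ ≤ a)

-- expScaled k N = N! * Σ_{j=0}^{N} k^j / j!   (= Σ_j k^j · N!/j!, a natural number)
expScaled : ℕ → ℕ → ℕ
expScaled k zero    = 1
expScaled k (suc N) = suc N * expScaled k N + k ^ suc N

-- For naturals k, m and a ≥ 1:  e^k ≤ (m / a)^p  holds iff for every N,
-- Σ_{j≤N} k^j/j! ≤ (m/a)^p, i.e. expScaled k N * a^p ≤ N! * m^p.
ExpLe : (k m a p : ℕ) → Set
ExpLe k m a p = ∀ N → expScaled k N * a ^ p ≤ (N !) * m ^ p

-- Bound (a):  g ≤ r · log₂(n+1)   ⇔   2^g ≤ (n+1)^r   (for r ≥ 1).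
BoundA : (r n g : ℕ) → Set
BoundA r n g = 2 ^ g ≤ suc n ^ r

-- Bound (b):  g ≤ r α (1 + 2 ln(n/α))
--   ⇔  g ≤ rα  or  e^(g − rα) ≤ (n/α)^(2rα)   (for r, α ≥ 1).
BoundB : (r n a g : ℕ) → Set
BoundB r n a g = (g ≤ r * a) ⊎ Σ ℕ (λ k → (g ≡ r * a + k) × ExpLe k n a (2 * (r * a)))

-- Both bounds come from a greedy construction. In an orientation of a graph the closed
-- degree sum Σ_{v∈U} (1 + deg_U v) counts every arc twice, so Turán's bound
-- |U|² ≤ α(U) Σ_{v∈U} (1 + deg_U v) yields a vertex v ∈ U with |U| ≤ α (1 + 2 d⁺_U(v)).
-- Choosing v and discarding v with its out-neighbours leaves at most (|U| - 1)/2 vertices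
-- when α = 1, and at most (1 - 1/2α)|U| vertices in general. Iterating gives a dominating
-- set of size at most log₂(n + 1) for tournaments, and of size at most α + K with
-- (1 + 1/(2α - 1))^K ≤ n/α in general, the last fewer than α vertices being taken whole.
-- Repeating this r times on the vertices not yet chosen gives an r-dominating set. Finally
-- e ≤ (1 + 1/M)^(M + 1) for M = 2α - 1, read off the binomial series of (1 - 1/(M + 1))^(-L),
-- turns (1 + 1/M)^K ≤ n/α into K ≤ 2α ln(n/α).

module Submission where

open import Defs hiding (sym)
open import Data.Bool using (Bool; true; false; not; _∧_; _∨_)
open import Data.Bool.Properties using (∧-distribˡ-∨; ∧-distribʳ-∨; ∧-zeroʳ) renaming (_≟_ to _≟ᵇ_)
open import Data.Empty using (⊥; ⊥-elim)
open import Data.Fin using (Fin; zero; suc; _≟_)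
open import Data.Fin.Properties using (any?)
import Data.Fin.Subset as Sub
import Data.Fin.Subset.Properties as Sub
open import Data.Nat
  using (ℕ; zero; suc; pred; _+_; _*_; _∸_; _^_; _≤_; _<_; z≤n; s≤s; s≤s⁻¹; _≤?_; _<?_; _!; NonZero)
open import Data.Nat.Induction using (<-wellFounded)
open import Data.Nat.Properties hiding (_≟_)
open import Algebra.Properties.CommutativeMonoid.Sum +-0-commutativeMonoid
  using (sum; sum-syntax; sum-cong-≗; sum-replicate-zero; ∑-distrib-+; ∑-comm)
open import Algebra.Properties.Semiring.Sum +-*-semiring using (*-distribˡ-sum; *-distribʳ-sum)
open import Data.Nat.Tactic.RingSolver using (solve; solve-∀)
open import Data.List using ([]; _∷_)
open import Data.Product using (_×_; _,_; proj₁; proj₂; ∃-syntax)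
open import Data.Sum using (_⊎_; inj₁; inj₂)
import Data.Vec as Vec
open import Data.Vec using (tabulate; lookup)
open import Data.Vec.Properties using (lookup∘tabulate; lookup-zipWith; []=⇒lookup; lookup⇒[]=)
open import Function using (_∘_)
open import Induction.WellFounded using (Acc; acc)
open import Relation.Nullary using (Dec; yes; no; does; ¬_; contradiction)
open import Relation.Nullary.Decidable using (dec-true; _×-dec_)
open import Relation.Binary.PropositionalEquality
  using (_≡_; refl; sym; trans; cong; cong₂; subst; subst₂; module ≡-Reasoning)

sum-mono-≤ : ∀ {n} {f g : Fin n → ℕ} → (∀ i → f i ≤ g i) → sum f ≤ sum g
sum-mono-≤ {zero}  f≤g = z≤n
sum-mono-≤ {suc n} f≤g = +-mono-≤ (f≤g zero) (sum-mono-≤ (f≤g ∘ suc))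

f[i]≤sum : ∀ {n} (f : Fin n → ℕ) i → f i ≤ sum f
f[i]≤sum f zero    = m≤m+n _ _
f[i]≤sum f (suc i) = ≤-trans (f[i]≤sum (f ∘ suc) i) (m≤n+m _ _)

⟦_⟧ : Bool → ℕ
⟦ true  ⟧ = 1
⟦ false ⟧ = 0

⟦⟧≤1 : ∀ x → ⟦ x ⟧ ≤ 1
⟦⟧≤1 true  = ≤-refl
⟦⟧≤1 false = z≤n

⟦∧⟧ : ∀ x y → ⟦ x ∧ y ⟧ ≡ ⟦ x ⟧ * ⟦ y ⟧
⟦∧⟧ true  y = sym (+-identityʳ _)
⟦∧⟧ false y = refl

⟦⟧*⟦∧⟧-swap : ∀ x y z → ⟦ x ⟧ * ⟦ y ∧ z ⟧ ≡ ⟦ y ⟧ * ⟦ x ∧ z ⟧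
⟦⟧*⟦∧⟧-swap false false z = refl
⟦⟧*⟦∧⟧-swap false true  z = refl
⟦⟧*⟦∧⟧-swap true  false z = refl
⟦⟧*⟦∧⟧-swap true  true  z = refl

⟦∨⟧ : ∀ x y → (x ≡ true → y ≡ false) → ⟦ x ∨ y ⟧ ≡ ⟦ x ⟧ + ⟦ y ⟧
⟦∨⟧ true  y disj rewrite disj refl = refl
⟦∨⟧ false y disj = refl

⟦⟧-split : ∀ x c → ⟦ x ⟧ ≡ ⟦ x ∧ not c ⟧ + ⟦ x ∧ c ⟧
⟦⟧-split true  true  = refl
⟦⟧-split true  false = refl
⟦⟧-split false c     = refl

∧-≡-trueˡ : ∀ {x y} → x ∧ y ≡ true → x ≡ true
∧-≡-trueˡ {true} _ = refl

∧-≡-trueʳ : ∀ {x y} → x ∧ y ≡ true → y ≡ true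
∧-≡-trueʳ {true} h = h

∧-≡-true⁺ : ∀ {x y} → x ≡ true → y ≡ true → x ∧ y ≡ true
∧-≡-true⁺ refl refl = refl

∨-≡-true⁻ : ∀ {x y} → x ∨ y ≡ true → x ≡ true ⊎ y ≡ true
∨-≡-true⁻ {true}  _ = inj₁ refl
∨-≡-true⁻ {false} h = inj₂ h

∨-≡-trueˡ⁺ : ∀ {x y} → x ≡ true → x ∨ y ≡ true
∨-≡-trueˡ⁺ refl = refl

∨-≡-trueʳ⁺ : ∀ {x y} → y ≡ true → x ∨ y ≡ true
∨-≡-trueʳ⁺ {true}  _ = refl
∨-≡-trueʳ⁺ {false} h = h

∨-≡-false⁻ : ∀ {x y} → x ∨ y ≡ false → x ≡ false × y ≡ false
∨-≡-false⁻ {false} h = refl , h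

not-≡-true⁻ : ∀ {x} → not x ≡ true → x ≡ false
not-≡-true⁻ {false} _ = refl

-- Finite vertex sets

FSubset : ℕ → Set
FSubset n = Fin n → Bool

module _ {n : ℕ} where

  infix  4 _∈_ _∉_ _⊆_
  infixr 7 _∩_
  infixr 6 _∪_ _─_

  _∈_ _∉_ : Fin n → FSubset n → Set
  i ∈ U = U i ≡ true
  i ∉ U = U i ≡ false

  _⊆_ : FSubset n → FSubset n → Set
  U ⊆ V = ∀ i → i ∈ U → i ∈ V

  ∅ ⊤ : FSubset n
  ∅ _ = false
  ⊤ _ = true

  ⁅_⁆ : Fin n → FSubset n
  ⁅ v ⁆ i = does (i ≟ v)

  _∩_ _∪_ _─_ : FSubset n → FSubset n → FSubset n
  (U ∩ V) i = U i ∧ V i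
  (U ∪ V) i = U i ∨ V i
  (U ─ V) i = U i ∧ not (V i)

  size : FSubset n → ℕ
  size U = ∑[ i < n ] ⟦ U i ⟧

  sumOver : FSubset n → (Fin n → ℕ) → ℕ
  sumOver U f = ∑[ i < n ] (⟦ U i ⟧ * f i)

  syntax sumOver U (λ v → e) = ∑[ v ∈ U ] e

  ∈⁅⁆ : ∀ v → v ∈ ⁅ v ⁆
  ∈⁅⁆ v = dec-true (v ≟ v) refl

  ∈⁅⁆⇒≡ : ∀ {i v} → i ∈ ⁅ v ⁆ → i ≡ v
  ∈⁅⁆⇒≡ {i} {v} h with i ≟ v
  ... | yes i≡v = i≡v

  ∈∧∉⇒⊥ : ∀ {i} {U : FSubset n} → i ∈ U → i ∉ U → ⊥
  ∈∧∉⇒⊥ i∈U i∉U = contradiction (trans (sym i∈U) i∉U) λ ()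

  ¬∈⇒∉ : ∀ {i} {U : FSubset n} → ¬ i ∈ U → i ∉ U
  ¬∈⇒∉ {i} {U} i∉U with U i
  ... | true  = contradiction refl i∉U
  ... | false = refl

  ─⁻ : ∀ {i U C} → i ∈ U ─ C → i ∈ U × i ∉ C
  ─⁻ h = ∧-≡-trueˡ h , not-≡-true⁻ (∧-≡-trueʳ h)

  ─⊆ : ∀ U C → U ─ C ⊆ U
  ─⊆ U C i = ∧-≡-trueˡ

  ∩⊆ : ∀ U C → U ∩ C ⊆ U
  ∩⊆ U C i = ∧-≡-trueˡ

  ⁅⁆⊆ : ∀ {i U} → i ∈ U → ⁅ i ⁆ ⊆ U
  ⁅⁆⊆ {U = U} i∈U j j∈⁅i⁆ = subst (_∈ U) (sym (∈⁅⁆⇒≡ j∈⁅i⁆)) i∈U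

  nonempty? : (U : FSubset n) → Dec (∃[ i ] i ∈ U)
  nonempty? U = any? (λ i → U i ≟ᵇ true)

  size-cong : ∀ {U V : FSubset n} → (∀ i → U i ≡ V i) → size U ≡ size V
  size-cong U≗V = sum-cong-≗ (cong ⟦_⟧ ∘ U≗V)

  size≤n : ∀ U → size U ≤ n
  size≤n U = ≤-trans (sum-mono-≤ (⟦⟧≤1 ∘ U)) (≤-reflexive (sum-1 n))
    where
    sum-1 : ∀ m → ∑[ i < m ] 1 ≡ m
    sum-1 zero    = refl
    sum-1 (suc m) = cong suc (sum-1 m)

  size-mono : ∀ {U V} → U ⊆ V → size U ≤ size V
  size-mono {U} {V} U⊆V = sum-mono-≤ ⟦⟧-mono
    where
    ⟦⟧-mono : ∀ i → ⟦ U i ⟧ ≤ ⟦ V i ⟧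
    ⟦⟧-mono i with U i in eq
    ... | true  rewrite U⊆V i eq = ≤-refl
    ... | false = z≤n

  size-∅ : size ∅ ≡ 0
  size-∅ = sum-replicate-zero n

  ∄⇒size≡0 : ∀ {U} → ¬ (∃[ i ] i ∈ U) → size U ≡ 0
  ∄⇒size≡0 {U} ∄ = trans (size-cong λ i → ¬∈⇒∉ {U = U} λ i∈U → ∄ (i , i∈U)) size-∅

  ∈⇒size>0 : ∀ {U i} → i ∈ U → 1 ≤ size U
  ∈⇒size>0 {U} {i} i∈U = subst (λ b → ⟦ b ⟧ ≤ size U) i∈U (f[i]≤sum (⟦_⟧ ∘ U) i)

  size-∪ : ∀ {U V} → (∀ i → i ∈ U → i ∉ V) → size (U ∪ V) ≡ size U + size V
  size-∪ {U} {V} disjoint =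
    trans (sum-cong-≗ (λ i → ⟦∨⟧ (U i) (V i) (disjoint i))) (∑-distrib-+ (⟦_⟧ ∘ U) (⟦_⟧ ∘ V))

  size-split : ∀ U C → size U ≡ size (U ─ C) + size (U ∩ C)
  size-split U C =
    trans (sum-cong-≗ (λ i → ⟦⟧-split (U i) (C i))) (∑-distrib-+ (⟦_⟧ ∘ (U ─ C)) (⟦_⟧ ∘ (U ∩ C)))

  sum-⁅⁆ : ∀ v (f : Fin n → ℕ) → ∑[ i ∈ ⁅ v ⁆ ] f i ≡ f v
  sum-⁅⁆ v f = go v f
    where
    go : ∀ {m} (v : Fin m) (f : Fin m → ℕ) → ∑[ i < m ] (⟦ does (i ≟ v) ⟧ * f i) ≡ f v
    go {suc m} zero    f = trans (cong (f zero + 0 +_) (sum-replicate-zero m))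
                                 (trans (+-identityʳ _) (+-identityʳ _))
    go {suc m} (suc v) f = go v (f ∘ suc)

  size-⁅⁆ : ∀ v → size ⁅ v ⁆ ≡ 1
  size-⁅⁆ v = trans (sum-cong-≗ {y = λ i → ⟦ ⁅ v ⁆ i ⟧ * 1} (λ i → sym (*-identityʳ _)))
                    (sum-⁅⁆ v (λ _ → 1))

  size-⁅⁆∪ : ∀ {v S} → v ∉ S → size (⁅ v ⁆ ∪ S) ≡ suc (size S)
  size-⁅⁆∪ {v} {S} v∉S = trans (size-∪ v∉S′) (cong (_+ size S) (size-⁅⁆ v))
    where
    v∉S′ : ∀ i → i ∈ ⁅ v ⁆ → i ∉ S
    v∉S′ i i∈⁅v⁆ = subst (_∉ S) (sym (∈⁅⁆⇒≡ i∈⁅v⁆)) v∉S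

  size-insert : ∀ {U A v} → v ∈ U → v ∉ A → size (U ∩ (⁅ v ⁆ ∪ A)) ≡ suc (size (U ∩ A))
  size-insert {U} {A} {v} v∈U v∉A = begin
      size (U ∩ (⁅ v ⁆ ∪ A))
    ≡⟨ size-cong (λ i → ∧-distribˡ-∨ (U i) (⁅ v ⁆ i) (A i)) ⟩
      size (U ∩ ⁅ v ⁆ ∪ U ∩ A)
    ≡⟨ size-∪ (λ i i∈⁅v⁆ → ∉A (∈⁅⁆⇒≡ (∧-≡-trueʳ i∈⁅v⁆))) ⟩
      size (U ∩ ⁅ v ⁆) + size (U ∩ A)
    ≡⟨ cong (_+ size (U ∩ A)) (trans (size-cong U∩⁅v⁆≗⁅v⁆) (size-⁅⁆ v)) ⟩
      suc (size (U ∩ A))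
    ∎
    where
    open ≡-Reasoning
    ∉A : ∀ {i} → i ≡ v → U i ∧ A i ≡ false
    ∉A refl rewrite v∉A = ∧-zeroʳ (U v)
    U∩⁅v⁆≗⁅v⁆ : ∀ i → U i ∧ ⁅ v ⁆ i ≡ ⁅ v ⁆ i
    U∩⁅v⁆≗⁅v⁆ i with i ≟ v
    ... | yes refl rewrite v∈U = refl
    ... | no _ = ∧-zeroʳ (U i)

  sumOver-const : ∀ U c → ∑[ i ∈ U ] c ≡ size U * c
  sumOver-const U c = sym (*-distribʳ-sum c (⟦_⟧ ∘ U))

  sumOver-mono : ∀ {U} {f g : Fin n → ℕ} → (∀ i → i ∈ U → f i ≤ g i) →
                 ∑[ i ∈ U ] f i ≤ ∑[ i ∈ U ] g i
  sumOver-mono {U} f≤g = sum-mono-≤ restricted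
    where
    restricted : ∀ i → ⟦ U i ⟧ * _ ≤ ⟦ U i ⟧ * _
    restricted i with U i in eq
    ... | true  = *-monoʳ-≤ 1 (f≤g i eq)
    ... | false = z≤n

  sumOver-split : ∀ U C (f : Fin n → ℕ) → ∑[ i ∈ U ] f i ≡ ∑[ i ∈ U ─ C ] f i + ∑[ i ∈ U ∩ C ] f i
  sumOver-split U C f =
    trans (sum-cong-≗ (λ i → trans (cong (_* f i) (⟦⟧-split (U i) (C i)))
                                   (*-distribʳ-+ (f i) ⟦ (U ─ C) i ⟧ ⟦ (U ∩ C) i ⟧)))
          (∑-distrib-+ (λ i → ⟦ (U ─ C) i ⟧ * f i) (λ i → ⟦ (U ∩ C) i ⟧ * f i))

  minimiser : ∀ (f : Fin n → ℕ) {U i} → i ∈ U → ∃[ v ] v ∈ U × (∀ w → w ∈ U → f v ≤ f w)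
  minimiser f {U} {i} i∈U = go i i∈U (<-wellFounded (f i))
    where
    go : ∀ v → v ∈ U → Acc _<_ (f v) → ∃[ v ] v ∈ U × (∀ w → w ∈ U → f v ≤ f w)
    go v v∈U (acc rs) with any? (λ w → (U w ≟ᵇ true) ×-dec (f w <? f v))
    ... | yes (w , w∈U , fw<fv) = go w w∈U (rs fw<fv)
    ... | no  none = v , v∈U , λ w w∈U → ≮⇒≥ (λ fw<fv → none (w , w∈U , fw<fv))

-- Turán's bound

2xy≤x²+y² : ∀ x y → 2 * x * y ≤ x * x + y * y
2xy≤x²+y² zero    y       = z≤n
2xy≤x²+y² (suc x) zero    = subst (_≤ suc x * suc x + 0) (sym (*-zeroʳ (2 * suc x))) z≤n
2xy≤x²+y² (suc x) (suc y) = begin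
    2 * suc x * suc y
  ≡⟨ solve (x ∷ y ∷ []) ⟩
    2 * x * y + (2 * x + 2 * y + 2)
  ≤⟨ +-monoˡ-≤ _ (2xy≤x²+y² x y) ⟩
    x * x + y * y + (2 * x + 2 * y + 2)
  ≡⟨ solve (x ∷ y ∷ []) ⟩
    suc x * suc x + suc y * suc y
  ∎
  where open ≤-Reasoning

-- Multiplied by b, this is AM-GM for m and b d.
cross-term-≤ : ∀ b m d w → m * m ≤ b * w → 2 * m * d ≤ w + b * (d * d)
cross-term-≤ zero zero d w _ = z≤n
cross-term-≤ b@(suc c) m d w m²≤bw = *-cancelˡ-≤ b (begin
    b * (2 * m * d)
  ≡⟨ solve (c ∷ m ∷ d ∷ []) ⟩
    2 * m * (b * d)
  ≤⟨ 2xy≤x²+y² m (b * d) ⟩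
    m * m + b * d * (b * d)
  ≤⟨ +-monoˡ-≤ _ m²≤bw ⟩
    b * w + b * d * (b * d)
  ≡⟨ solve (c ∷ d ∷ w ∷ []) ⟩
    b * (w + b * (d * d))
  ∎)
  where open ≤-Reasoning

square-step : ∀ b m d w → m * m ≤ b * w → (m + d) * (m + d) ≤ suc b * (w + d * d)
square-step b m d w m²≤bw = begin
    (m + d) * (m + d)
  ≡⟨ solve (m ∷ d ∷ []) ⟩
    m * m + 2 * m * d + d * d
  ≤⟨ +-monoˡ-≤ (d * d) (+-mono-≤ m²≤bw (cross-term-≤ b m d w m²≤bw)) ⟩
    b * w + (w + b * (d * d)) + d * d
  ≡⟨ solve (b ∷ d ∷ w ∷ []) ⟩
    suc b * (w + d * d)
  ∎
  where open ≤-Reasoning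

module _ {n : ℕ} (G : Graph n) where

  Independent : FSubset n → Set
  Independent P = ∀ u v → u ∈ P → v ∈ P → adj G u v ≡ false

  IndependenceAtMost : FSubset n → ℕ → Set
  IndependenceAtMost U a = ∀ P → P ⊆ U → Independent P → size P ≤ a

  IndependenceAtMost-mono : ∀ {U V a} → U ⊆ V → IndependenceAtMost V a → IndependenceAtMost U a
  IndependenceAtMost-mono U⊆V α≤a P P⊆U = α≤a P (λ i → U⊆V i ∘ P⊆U i)

  ⁅⁆-independent : ∀ v → Independent ⁅ v ⁆
  ⁅⁆-independent v u w u∈⁅v⁆ w∈⁅v⁆
    with refl ← ∈⁅⁆⇒≡ {i = u} {v = v} u∈⁅v⁆ | refl ← ∈⁅⁆⇒≡ {i = w} {v = v} w∈⁅v⁆ = Graph.irrefl G u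

  N[_] : Fin n → FSubset n
  N[ v ] = ⁅ v ⁆ ∪ adj G v

  deg : FSubset n → Fin n → ℕ
  deg U v = size (U ∩ adj G v)

  closedDegreeSum : FSubset n → ℕ
  closedDegreeSum U = ∑[ v ∈ U ] suc (deg U v)

  size-N[] : ∀ {U v} → v ∈ U → size (U ∩ N[ v ]) ≡ suc (deg U v)
  size-N[] {U} {v} v∈U = size-insert {U = U} {A = adj G v} v∈U (Graph.irrefl G v)

  deg-mono : ∀ {U V} → U ⊆ V → ∀ v → deg U v ≤ deg V v
  deg-mono U⊆V v = size-mono λ i i∈ → ∧-≡-true⁺ (U⊆V i (∧-≡-trueˡ i∈)) (∧-≡-trueʳ i∈)

  independence-remove-N[] : ∀ {U v b} → v ∈ U → IndependenceAtMost U (suc b) →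
                            IndependenceAtMost (U ─ N[ v ]) b
  independence-remove-N[] {U} {v} v∈U α≤1+b P P⊆U─N[v] P-independent =
    s≤s⁻¹ (subst (_≤ suc _) (size-⁅⁆∪ {v = v} {S = P} v∉P)
                  (α≤1+b (⁅ v ⁆ ∪ P) v∪P⊆U v∪P-independent))
    where
    outside : ∀ {u} → u ∈ P → u ∈ U × u ∉ ⁅ v ⁆ × adj G v u ≡ false
    outside {u} u∈P with ─⁻ {i = u} {U} {N[ v ]} (P⊆U─N[v] u u∈P)
    ... | u∈U , u∉N[v] = u∈U , ∨-≡-false⁻ u∉N[v]
    v∉P : v ∉ P
    v∉P = ¬∈⇒∉ {U = P} λ v∈P → ∈∧∉⇒⊥ {i = v} {U = ⁅ v ⁆} (∈⁅⁆ v) (proj₁ (proj₂ (outside {v} v∈P)))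
    v∪P⊆U : ⁅ v ⁆ ∪ P ⊆ U
    v∪P⊆U i i∈ with ∨-≡-true⁻ i∈
    ... | inj₁ i∈⁅v⁆ = ⁅⁆⊆ v∈U i i∈⁅v⁆
    ... | inj₂ i∈P   = proj₁ (outside i∈P)
    v∪P-independent : Independent (⁅ v ⁆ ∪ P)
    v∪P-independent u w u∈ w∈ with ∨-≡-true⁻ u∈ | ∨-≡-true⁻ w∈
    ... | inj₁ u∈⁅v⁆ | inj₁ w∈⁅v⁆ = ⁅⁆-independent v u w u∈⁅v⁆ w∈⁅v⁆
    ... | inj₁ u∈⁅v⁆ | inj₂ w∈P  with refl ← ∈⁅⁆⇒≡ {i = u} {v = v} u∈⁅v⁆ =
      proj₂ (proj₂ (outside w∈P))
    ... | inj₂ u∈P  | inj₁ w∈⁅v⁆ with refl ← ∈⁅⁆⇒≡ {i = w} {v = v} w∈⁅v⁆ =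
      trans (Graph.sym G u w) (proj₂ (proj₂ (outside u∈P)))
    ... | inj₂ u∈P  | inj₂ w∈P  = P-independent u w u∈P w∈P

  closedDegreeSum-remove-N[] : ∀ {U v} → v ∈ U → (∀ w → w ∈ U → deg U v ≤ deg U w) →
    closedDegreeSum (U ─ N[ v ]) + suc (deg U v) * suc (deg U v) ≤ closedDegreeSum U
  closedDegreeSum-remove-N[] {U} {v} v∈U v-min = begin
      closedDegreeSum U′ + d * d
    ≤⟨ +-mono-≤ (sumOver-mono {U = U′} λ w _ → s≤s (deg-mono (─⊆ U N[ v ]) w)) d*d≤ ⟩
      ∑[ w ∈ U′ ] suc (deg U w) + ∑[ w ∈ U ∩ N[ v ] ] suc (deg U w)
    ≡⟨ sym (sumOver-split U N[ v ] (suc ∘ deg U)) ⟩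
      closedDegreeSum U
    ∎
    where
    open ≤-Reasoning
    U′ = U ─ N[ v ]
    d = suc (deg U v)
    d*d≤ : d * d ≤ ∑[ w ∈ U ∩ N[ v ] ] suc (deg U w)
    d*d≤ = begin
        d * d
      ≡⟨ cong (_* d) (sym (size-N[] v∈U)) ⟩
        size (U ∩ N[ v ]) * d
      ≡⟨ sym (sumOver-const (U ∩ N[ v ]) d) ⟩
        ∑[ w ∈ U ∩ N[ v ] ] d
      ≤⟨ sumOver-mono {U = U ∩ N[ v ]} (λ w w∈ → s≤s (v-min w (∩⊆ U N[ v ] w w∈))) ⟩
        ∑[ w ∈ U ∩ N[ v ] ] suc (deg U w)
      ∎

  turán : ∀ a U → IndependenceAtMost U a → size U * size U ≤ a * closedDegreeSum U
  turán a U α≤a with nonempty? U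
  ... | no ∄ = subst (λ m → m * m ≤ a * closedDegreeSum U) (sym (∄⇒size≡0 {U = U} ∄)) z≤n
  turán zero U α≤0 | yes (i , i∈U) =
    contradiction (subst (_≤ 0) (size-⁅⁆ i) (α≤0 ⁅ i ⁆ (⁅⁆⊆ {U = U} i∈U) (⁅⁆-independent i))) λ ()
  turán (suc b) U α≤1+b | yes (i , i∈U) with minimiser (deg U) {U} i∈U
  ... | v , v∈U , v-min = begin
      size U * size U
    ≡⟨ cong (λ m → m * m) (trans (size-split U N[ v ]) (cong (size U′ +_) (size-N[] v∈U))) ⟩
      (size U′ + d) * (size U′ + d)
    ≤⟨ square-step b (size U′) d _ (turán b U′ (independence-remove-N[] v∈U α≤1+b)) ⟩
      suc b * (closedDegreeSum U′ + d * d)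
    ≤⟨ *-monoʳ-≤ (suc b) (closedDegreeSum-remove-N[] v∈U v-min) ⟩
      suc b * closedDegreeSum U
    ∎
    where
    open ≤-Reasoning
    U′ = U ─ N[ v ]
    d = suc (deg U v)

-- Orientations and greedy domination

tournament-step : ∀ c′ o {c} → c ≡ c′ + suc o → c ≤ 1 * suc (2 * o) → 2 * suc c′ ≤ suc c
tournament-step c′ o refl c≤ = begin
    2 * suc c′
  ≡⟨ solve (c′ ∷ []) ⟩
    suc (c′ + suc c′)
  ≤⟨ s≤s (+-monoʳ-≤ c′ (s≤s c′≤o)) ⟩
    suc (c′ + suc o)
  ∎
  where
  open ≤-Reasoning
  c′≤o : c′ ≤ o
  c′≤o = +-cancelʳ-≤ (suc o) c′ o (≤-trans c≤ (≤-reflexive (solve (o ∷ []))))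

shrink-step : ∀ a M c′ o {c} → 2 * a ≡ suc M → c ≡ c′ + suc o → c ≤ a * suc (2 * o) →
              suc M * c′ ≤ M * c
shrink-step a M c′ o 2a≡1+M refl c≤ = begin
    suc M * c′
  ≡⟨ +-comm c′ (M * c′) ⟩
    M * c′ + c′
  ≤⟨ +-monoʳ-≤ (M * c′) c′≤M[1+o] ⟩
    M * c′ + M * suc o
  ≡⟨ sym (*-distribˡ-+ M c′ (suc o)) ⟩
    M * (c′ + suc o)
  ∎
  where
  open ≤-Reasoning
  c′≤M[1+o] : c′ ≤ M * suc o
  c′≤M[1+o] = +-cancelʳ-≤ (suc o) c′ (M * suc o) (begin
      c′ + suc o
    ≤⟨ c≤ ⟩
      a * suc (2 * o)
    ≤⟨ m≤m+n _ a ⟩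
      a * suc (2 * o) + a
    ≡⟨ solve (a ∷ o ∷ []) ⟩
      2 * a * suc o
    ≡⟨ cong (_* suc o) 2a≡1+M ⟩
      suc M * suc o
    ≡⟨ +-comm (suc o) (M * suc o) ⟩
      M * suc o + suc o
    ∎)

geometric-shrink : ∀ {M n c c′} j → suc M * c′ ≤ M * c → c * suc M ^ j ≤ n * M ^ j →
                   c′ * suc M ^ suc j ≤ n * M ^ suc j
geometric-shrink {M} {n} {c} {c′} j shrink c≤ = begin
    c′ * (P * P ^ j)
  ≡⟨ sym (*-assoc c′ P (P ^ j)) ⟩
    c′ * P * P ^ j
  ≡⟨ cong (_* P ^ j) (*-comm c′ P) ⟩
    P * c′ * P ^ j
  ≤⟨ *-monoˡ-≤ (P ^ j) shrink ⟩
    M * c * P ^ j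
  ≡⟨ *-assoc M c (P ^ j) ⟩
    M * (c * P ^ j)
  ≤⟨ *-monoʳ-≤ M c≤ ⟩
    M * (n * M ^ j)
  ≡⟨ sym (*-assoc M n (M ^ j)) ⟩
    M * n * M ^ j
  ≡⟨ cong (_* M ^ j) (*-comm M n) ⟩
    n * M * M ^ j
  ≡⟨ *-assoc n M (M ^ j) ⟩
    n * (M * M ^ j)
  ∎
  where
  open ≤-Reasoning
  P = suc M

geometric-stop : ∀ {a M n c} j → c * suc M ^ j ≤ n * M ^ j → ¬ (a * suc M ^ j ≤ n * M ^ j) →
                 c + j ≤ a + pred j
geometric-stop {a} {M} {n} {c} j c≤ a≰ = begin
    c + j
  ≤⟨ +-monoʳ-≤ c (j≤1+pred[j] j) ⟩
    c + suc (pred j)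
  ≡⟨ +-suc c (pred j) ⟩
    suc c + pred j
  ≤⟨ +-monoˡ-≤ (pred j) c<a ⟩
    a + pred j
  ∎
  where
  open ≤-Reasoning
  c<a : c < a
  c<a = *-cancelʳ-< _ c a (≤-<-trans c≤ (≰⇒> a≰))
  j≤1+pred[j] : ∀ j → j ≤ suc (pred j)
  j≤1+pred[j] zero    = z≤n
  j≤1+pred[j] (suc j) = ≤-refl

-- a (M + 1)^K ≤ n M^K says (1 + 1/M)^K ≤ n/a.
GeometricBound : (a M n j s : ℕ) → Set
GeometricBound a M n j s = ∃[ K ] s + j ≤ a + K × a * suc M ^ K ≤ n * M ^ K

RoundsBound : (a M n t s : ℕ) → Set
RoundsBound a M n t s = ∃[ K ] s ≤ t * a + K × a ^ t * suc M ^ K ≤ n ^ t * M ^ K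

RoundsBound-suc : ∀ {a M n} t s₁ s₂ → GeometricBound a M n 0 s₁ → RoundsBound a M n t s₂ →
                  RoundsBound a M n (suc t) (s₁ + s₂)
RoundsBound-suc {a} {M} {n} t s₁ s₂ (K₁ , s₁≤ , bound₁) (K₂ , s₂≤ , bound₂) =
  K₁ + K₂ , sum≤ , (begin
    a * a ^ t * P ^ (K₁ + K₂)
  ≡⟨ cong (a * a ^ t *_) (^-distribˡ-+-* P K₁ K₂) ⟩
    a * a ^ t * (P ^ K₁ * P ^ K₂)
  ≡⟨ interchange a (a ^ t) (P ^ K₁) (P ^ K₂) ⟩
    (a * P ^ K₁) * (a ^ t * P ^ K₂)
  ≤⟨ *-mono-≤ bound₁ bound₂ ⟩
    (n * M ^ K₁) * (n ^ t * M ^ K₂)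
  ≡⟨ sym (interchange n (n ^ t) (M ^ K₁) (M ^ K₂)) ⟩
    n * n ^ t * (M ^ K₁ * M ^ K₂)
  ≡⟨ cong (n * n ^ t *_) (sym (^-distribˡ-+-* M K₁ K₂)) ⟩
    n * n ^ t * M ^ (K₁ + K₂)
  ∎)
  where
  open ≤-Reasoning
  P = suc M
  interchange : ∀ x y z w → x * y * (z * w) ≡ (x * z) * (y * w)
  interchange = solve-∀
  sum≤ : s₁ + s₂ ≤ suc t * a + (K₁ + K₂)
  sum≤ = begin
      s₁ + s₂
    ≤⟨ +-mono-≤ (subst (_≤ a + K₁) (+-identityʳ s₁) s₁≤) s₂≤ ⟩
      a + K₁ + (t * a + K₂)
    ≡⟨ solve (a ∷ t ∷ K₁ ∷ K₂ ∷ []) ⟩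
      suc t * a + (K₁ + K₂)
    ∎

module Domination {n : ℕ} (D : Digraph n) where

  outdeg : FSubset n → Fin n → ℕ
  outdeg U v = size (U ∩ D v)

  Dominates : FSubset n → FSubset n → Set
  Dominates U S = ∀ i → i ∈ U → i ∉ S → ∃[ s ] s ∈ S × D s i ≡ true

  record DominatingSet (U : FSubset n) (Q : ℕ → Set) : Set where
    constructor dominatingSet
    field
      S         : FSubset n
      S⊆U       : S ⊆ U
      dominates : Dominates U S
      bound     : Q (size S)

  weaken : ∀ {U Q Q′} → (∀ s → Q s → Q′ s) → DominatingSet U Q → DominatingSet U Q′
  weaken Q⇒Q′ (dominatingSet S S⊆U dominates bound) =
    dominatingSet S S⊆U dominates (Q⇒Q′ (size S) bound)

  ∅-dominatingSet : ∀ {U Q} → ¬ (∃[ i ] i ∈ U) → Q 0 → DominatingSet U Q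
  ∅-dominatingSet {Q = Q} ∄ q =
    dominatingSet ∅ (λ _ ()) (λ i i∈U _ → contradiction (i , i∈U) ∄)
                  (subst Q (sym (size-∅ {n})) q)

  self-dominatingSet : ∀ {U Q} → Q (size U) → DominatingSet U Q
  self-dominatingSet {U} =
    dominatingSet U (λ _ i∈U → i∈U) (λ i i∈U i∉U → ⊥-elim (∈∧∉⇒⊥ {U = U} i∈U i∉U))

  N⁺[_] : Fin n → FSubset n
  N⁺[ v ] = ⁅ v ⁆ ∪ D v

  extend : ∀ {U v Q Q′} → v ∈ U → DominatingSet (U ─ N⁺[ v ]) Q′ →
           (∀ s → Q′ s → Q (suc s)) → DominatingSet U Q
  extend {U} {v} {Q} v∈U (dominatingSet S S⊆U′ dominates bound) Q′⇒Q∘suc =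
    dominatingSet (⁅ v ⁆ ∪ S) v∪S⊆U v∪S-dominates
                  (subst Q (sym (size-⁅⁆∪ {v = v} {S = S} v∉S)) (Q′⇒Q∘suc (size S) bound))
    where
    v∉S : v ∉ S
    v∉S = ¬∈⇒∉ {U = S} λ v∈S → ∈∧∉⇒⊥ {i = v} {U = N⁺[ v ]} (∨-≡-trueˡ⁺ (∈⁅⁆ v))
                                       (proj₂ (─⁻ {i = v} {U = U} {C = N⁺[ v ]} (S⊆U′ v v∈S)))
    v∪S⊆U : ⁅ v ⁆ ∪ S ⊆ U
    v∪S⊆U i i∈ with ∨-≡-true⁻ i∈
    ... | inj₁ i∈⁅v⁆ = ⁅⁆⊆ {U = U} v∈U i i∈⁅v⁆
    ... | inj₂ i∈S   = ─⊆ U N⁺[ v ] i (S⊆U′ i i∈S)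
    v∪S-dominates : Dominates U (⁅ v ⁆ ∪ S)
    v∪S-dominates i i∈U i∉v∪S with D v i in vi | ∨-≡-false⁻ i∉v∪S
    ... | true  | _ = v , ∨-≡-trueˡ⁺ (∈⁅⁆ v) , vi
    ... | false | i∉⁅v⁆ , i∉S with dominates i (∧-≡-true⁺ i∈U (cong not (cong₂ _∨_ i∉⁅v⁆ vi))) i∉S
    ...   | s , s∈S , si = s , ∨-≡-trueʳ⁺ s∈S , si

  RDominates : ℕ → FSubset n → FSubset n → Set
  RDominates t U S = ∀ i → i ∈ U → i ∉ S → t ≤ size (S ∩ λ s → D s i)

  r-dominate : (Q : ℕ → Set) (B : ℕ → ℕ → Set) → (∀ U → DominatingSet U Q) → B 0 0 →
               (∀ t s₁ s₂ → Q s₁ → B t s₂ → B (suc t) (s₁ + s₂)) →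
               ∀ t U → ∃[ S ] S ⊆ U × RDominates t U S × B t (size S)
  r-dominate Q B dominate B0 Bsuc zero U =
    ∅ , (λ _ ()) , (λ _ _ _ → z≤n) , subst (B 0) (sym (size-∅ {n})) B0
  r-dominate Q B dominate B0 Bsuc (suc t) U with dominate U
  ... | dominatingSet S₁ S₁⊆U S₁-dominates q with r-dominate Q B dominate B0 Bsuc t (U ─ S₁)
  ... | T , T⊆U─S₁ , T-dominates , b =
    S₁ ∪ T , S₁∪T⊆U , S₁∪T-dominates ,
    subst (B (suc t)) (sym (size-∪ {U = S₁} disjoint)) (Bsuc t (size S₁) (size T) q b)
    where
    disjoint : ∀ i → i ∈ S₁ → i ∉ T
    disjoint i i∈S₁ = ¬∈⇒∉ {U = T} λ i∈T →
      ∈∧∉⇒⊥ {i = i} {U = S₁} i∈S₁ (proj₂ (─⁻ {i = i} {U = U} {C = S₁} (T⊆U─S₁ i i∈T)))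
    S₁∪T⊆U : S₁ ∪ T ⊆ U
    S₁∪T⊆U i i∈ with ∨-≡-true⁻ i∈
    ... | inj₁ i∈S₁ = S₁⊆U i i∈S₁
    ... | inj₂ i∈T  = ─⊆ U S₁ i (T⊆U─S₁ i i∈T)
    S₁∪T-dominates : RDominates (suc t) U (S₁ ∪ T)
    S₁∪T-dominates i i∈U i∉S₁∪T with ∨-≡-false⁻ i∉S₁∪T
    ... | i∉S₁ , i∉T with S₁-dominates i i∈U i∉S₁
    ...   | s , s∈S₁ , si = subst (suc t ≤_) (sym size≡)
              (+-mono-≤ (∈⇒size>0 {U = S₁ ∩ Dᵢ} (∧-≡-true⁺ s∈S₁ si))
                        (T-dominates i (∧-≡-true⁺ i∈U (cong not i∉S₁)) i∉T))
      where
      Dᵢ : FSubset n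
      Dᵢ s = D s i
      size≡ : size ((S₁ ∪ T) ∩ Dᵢ) ≡ size (S₁ ∩ Dᵢ) + size (T ∩ Dᵢ)
      size≡ = trans (size-cong (λ j → ∧-distribʳ-∨ (Dᵢ j) (S₁ j) (T j)))
                    (size-∪ {U = S₁ ∩ Dᵢ} λ j j∈ → cong (_∧ Dᵢ j) (disjoint j (∧-≡-trueˡ j∈)))

module _ {n : ℕ} (G : Graph n) (D : Digraph n) (D-orients : IsOrientation (adj G) D) where

  open Domination D

  private
    arc⇒edge = proj₁ D-orients
    arc-asym = proj₁ (proj₂ D-orients)
    edge⇒arc = proj₂ (proj₂ D-orients)

  indeg : FSubset n → Fin n → ℕ
  indeg U v = size (U ∩ λ i → D i v)

  D-irrefl : ∀ v → D v v ≡ false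
  D-irrefl v with D v v in vv
  ... | true  = contradiction (trans (sym (arc⇒edge v v vv)) (Graph.irrefl G v)) λ ()
  ... | false = refl

  ⟦adj⟧≡ : ∀ v i → ⟦ adj G v i ⟧ ≡ ⟦ D v i ⟧ + ⟦ D i v ⟧
  ⟦adj⟧≡ v i with adj G v i in e | D v i in vi | D i v in iv
  ... | _     | true  | true  = contradiction (trans (sym iv) (arc-asym v i vi)) λ ()
  ... | true  | true  | false = refl
  ... | true  | false | true  = refl
  ... | true  | false | false with edge⇒arc v i e
  ...   | inj₁ vi′ = contradiction (trans (sym vi′) vi) λ ()
  ...   | inj₂ iv′ = contradiction (trans (sym iv′) iv) λ ()
  ⟦adj⟧≡ v i | false | true  | false = contradiction (trans (sym (arc⇒edge v i vi)) e) λ ()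
  ⟦adj⟧≡ v i | false | false | true  =
    contradiction (trans (sym (trans (Graph.sym G v i) (arc⇒edge i v iv))) e) λ ()
  ⟦adj⟧≡ v i | false | false | false = refl

  deg≡outdeg+indeg : ∀ U v → deg G U v ≡ outdeg U v + indeg U v
  deg≡outdeg+indeg U v =
    trans (sum-cong-≗ term) (∑-distrib-+ (λ i → ⟦ U i ∧ D v i ⟧) (λ i → ⟦ U i ∧ D i v ⟧))
    where
    term : ∀ i → ⟦ U i ∧ adj G v i ⟧ ≡ ⟦ U i ∧ D v i ⟧ + ⟦ U i ∧ D i v ⟧
    term i rewrite ⟦∧⟧ (U i) (adj G v i) | ⟦∧⟧ (U i) (D v i) | ⟦∧⟧ (U i) (D i v) | ⟦adj⟧≡ v i =
      *-distribˡ-+ ⟦ U i ⟧ ⟦ D v i ⟧ ⟦ D i v ⟧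

  ∑indeg≡∑outdeg : ∀ U → ∑[ v ∈ U ] indeg U v ≡ ∑[ v ∈ U ] outdeg U v
  ∑indeg≡∑outdeg U = begin
      ∑[ v < n ] (⟦ U v ⟧ * ∑[ i < n ] ⟦ U i ∧ D i v ⟧)
    ≡⟨ sum-cong-≗ (λ v → *-distribˡ-sum ⟦ U v ⟧ (λ i → ⟦ U i ∧ D i v ⟧)) ⟩
      ∑[ v < n ] ∑[ i < n ] (⟦ U v ⟧ * ⟦ U i ∧ D i v ⟧)
    ≡⟨ ∑-comm (λ v i → ⟦ U v ⟧ * ⟦ U i ∧ D i v ⟧) ⟩
      ∑[ i < n ] ∑[ v < n ] (⟦ U v ⟧ * ⟦ U i ∧ D i v ⟧)
    ≡⟨ sum-cong-≗ (λ i → sum-cong-≗ (λ v → ⟦⟧*⟦∧⟧-swap (U v) (U i) (D i v))) ⟩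
      ∑[ i < n ] ∑[ v < n ] (⟦ U i ⟧ * ⟦ U v ∧ D i v ⟧)
    ≡⟨ sum-cong-≗ (λ i → sym (*-distribˡ-sum ⟦ U i ⟧ (λ v → ⟦ U v ∧ D i v ⟧))) ⟩
      ∑[ i < n ] (⟦ U i ⟧ * ∑[ v < n ] ⟦ U v ∧ D i v ⟧)
    ∎
    where open ≡-Reasoning

  closedDegreeSum≡ : ∀ U → closedDegreeSum G U ≡ size U + 2 * ∑[ v ∈ U ] outdeg U v
  closedDegreeSum≡ U = begin
      ∑[ v ∈ U ] suc (deg G U v)
    ≡⟨ sum-cong-≗ (λ v → trans (cong (λ d → ⟦ U v ⟧ * suc d) (deg≡outdeg+indeg U v))
                               (*-distribˡ-+ ⟦ U v ⟧ 1 (outdeg U v + indeg U v))) ⟩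
      ∑[ v < n ] (⟦ U v ⟧ * 1 + ⟦ U v ⟧ * (outdeg U v + indeg U v))
    ≡⟨ ∑-distrib-+ (λ v → ⟦ U v ⟧ * 1) (λ v → ⟦ U v ⟧ * (outdeg U v + indeg U v)) ⟩
      ∑[ v ∈ U ] 1 + ∑[ v < n ] (⟦ U v ⟧ * (outdeg U v + indeg U v))
    ≡⟨ cong₂ _+_ (trans (sumOver-const U 1) (*-identityʳ (size U)))
                 (trans (sum-cong-≗ (λ v → *-distribˡ-+ ⟦ U v ⟧ (outdeg U v) (indeg U v)))
                        (∑-distrib-+ (λ v → ⟦ U v ⟧ * outdeg U v) (λ v → ⟦ U v ⟧ * indeg U v))) ⟩
      size U + (∑[ v ∈ U ] outdeg U v + ∑[ v ∈ U ] indeg U v)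
    ≡⟨ cong (λ s → size U + (∑[ v ∈ U ] outdeg U v + s)) (∑indeg≡∑outdeg U) ⟩
      size U + (∑[ v ∈ U ] outdeg U v + ∑[ v ∈ U ] outdeg U v)
    ≡⟨ cong (size U +_) (sym (cong (∑[ v ∈ U ] outdeg U v +_) (+-identityʳ _))) ⟩
      size U + 2 * ∑[ v ∈ U ] outdeg U v
    ∎
    where open ≡-Reasoning

  ∑[1+a[1+2outdeg]]≡ : ∀ a U →
    ∑[ v ∈ U ] suc (a * suc (2 * outdeg U v)) ≡ size U + a * closedDegreeSum G U
  ∑[1+a[1+2outdeg]]≡ a U = begin
      ∑[ v < n ] (⟦ U v ⟧ * suc (a * suc (2 * outdeg U v)))
    ≡⟨ sum-cong-≗ (λ v → expand ⟦ U v ⟧ a (outdeg U v)) ⟩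
      ∑[ v < n ] (⟦ U v ⟧ + (a * ⟦ U v ⟧ + a * 2 * (⟦ U v ⟧ * outdeg U v)))
    ≡⟨ trans (∑-distrib-+ (⟦_⟧ ∘ U) _) (cong (m +_) (∑-distrib-+ (λ v → a * ⟦ U v ⟧) _)) ⟩
      m + (∑[ v < n ] (a * ⟦ U v ⟧) + ∑[ v < n ] (a * 2 * (⟦ U v ⟧ * outdeg U v)))
    ≡⟨ sym (cong₂ (λ x y → m + (x + y)) (*-distribˡ-sum a (⟦_⟧ ∘ U))
                                         (*-distribˡ-sum (a * 2) (λ v → ⟦ U v ⟧ * outdeg U v))) ⟩
      m + (a * m + a * 2 * S)
    ≡⟨ cong (m +_) (trans (cong (a * m +_) (*-assoc a 2 S)) (sym (*-distribˡ-+ a m (2 * S)))) ⟩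
      m + a * (m + 2 * S)
    ≡⟨ cong (λ w → m + a * w) (sym (closedDegreeSum≡ U)) ⟩
      m + a * closedDegreeSum G U
    ∎
    where
    open ≡-Reasoning
    m = size U
    S = ∑[ v ∈ U ] outdeg U v
    expand : ∀ x a o → x * suc (a * suc (2 * o)) ≡ x + (a * x + a * 2 * (x * o))
    expand = solve-∀

  large-outdegree : ∀ {a U} → IndependenceAtMost G U a → 1 ≤ size U →
                    ∃[ v ] v ∈ U × size U ≤ a * suc (2 * outdeg U v)
  large-outdegree {a} {U} α≤a 1≤m
    with any? (λ v → (U v ≟ᵇ true) ×-dec (size U ≤? a * suc (2 * outdeg U v)))
  ... | yes found = found
  ... | no  none  = contradiction (+-cancelʳ-≤ (a * W) m 0 m+aW≤aW) (<⇒≱ 1≤m)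
    where
    open ≤-Reasoning
    m = size U
    W = closedDegreeSum G U
    m+aW≤aW : m + a * W ≤ a * W
    m+aW≤aW = begin
        m + a * W
      ≡⟨ sym (∑[1+a[1+2outdeg]]≡ a U) ⟩
        ∑[ v ∈ U ] suc (a * suc (2 * outdeg U v))
      ≤⟨ sumOver-mono {U = U} (λ v v∈U → ≰⇒> λ m≤ → none (v , v∈U , m≤)) ⟩
        ∑[ v ∈ U ] m
      ≡⟨ sumOver-const U m ⟩
        m * m
      ≤⟨ turán G a U α≤a ⟩
        a * W
      ∎

  size-remove-N⁺[] : ∀ {U v} → v ∈ U → size U ≡ size (U ─ N⁺[ v ]) + suc (outdeg U v)
  size-remove-N⁺[] {U} {v} v∈U =
    trans (size-split U N⁺[ v ])
          (cong (size (U ─ N⁺[ v ]) +_) (size-insert {U = U} v∈U (D-irrefl v)))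

  size-remove-N⁺[]< : ∀ {U v} → v ∈ U → size (U ─ N⁺[ v ]) < size U
  size-remove-N⁺[]< {U} {v} v∈U =
    subst (size (U ─ N⁺[ v ]) <_) (sym (size-remove-N⁺[] {U = U} {v} v∈U)) (m<m+n _ (s≤s z≤n))

  dominate-tournament : IndependenceAtMost G ⊤ 1 →
                        ∀ U → DominatingSet U (λ s → 2 ^ s ≤ suc (size U))
  dominate-tournament α≤1 U = go U (<-wellFounded (size U))
    where
    go : ∀ U → Acc _<_ (size U) → DominatingSet U (λ s → 2 ^ s ≤ suc (size U))
    go U (acc rs) with nonempty? U
    ... | no ∄ = ∅-dominatingSet ∄ (s≤s z≤n)
    ... | yes (i , i∈U)
      with large-outdegree {U = U} (IndependenceAtMost-mono G (λ _ _ → refl) α≤1)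
                           (∈⇒size>0 {U = U} i∈U)
    ... | v , v∈U , U≤ =
      extend {v = v} v∈U (go (U ─ N⁺[ v ]) (rs (size-remove-N⁺[]< {U = U} {v} v∈U))) step
      where
      step : ∀ s → 2 ^ s ≤ suc (size (U ─ N⁺[ v ])) → 2 ^ suc s ≤ suc (size U)
      step _ 2^s≤ = ≤-trans (*-monoʳ-≤ 2 2^s≤)
        (tournament-step (size (U ─ N⁺[ v ])) (outdeg U v) (size-remove-N⁺[] {U = U} {v} v∈U) U≤)

  module _ {a M : ℕ} (2a≡1+M : 2 * a ≡ suc M) (a≤n : a ≤ n) (α≤a : IndependenceAtMost G ⊤ a) where

    dominate-geometric : ∀ U → DominatingSet U (GeometricBound a M n 0)
    dominate-geometric U =
      go 0 U (<-wellFounded (size U)) (*-monoˡ-≤ 1 (size≤n U)) (*-monoˡ-≤ 1 a≤n)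
      where
      -- After j greedy steps |U| ≤ n (M/(M + 1))^j; the last invariant makes K = j - 1
      -- admissible once the greedy stops.
      go : ∀ j U → Acc _<_ (size U) → size U * suc M ^ j ≤ n * M ^ j →
           a * suc M ^ pred j ≤ n * M ^ pred j → DominatingSet U (GeometricBound a M n j)
      go j U (acc rs) U≤ a≤ with a * suc M ^ j ≤? n * M ^ j
      ... | no a≰ = self-dominatingSet (pred j , geometric-stop {a} {M} {n} {size U} j U≤ a≰ , a≤)
      ... | yes a≤′ with nonempty? U
      ...   | no ∄ = ∅-dominatingSet ∄ (j , m≤n+m j a , a≤′)
      ...   | yes (i , i∈U)
        with large-outdegree {U = U} (IndependenceAtMost-mono G (λ _ _ → refl) α≤a)
                             (∈⇒size>0 {U = U} i∈U)
      ...   | v , v∈U , U≤a[1+2o] =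
        extend {v = v} v∈U (go (suc j) U′ (rs (size-remove-N⁺[]< {U = U} {v} v∈U)) U′≤ a≤′) shift
        where
        U′ = U ─ N⁺[ v ]
        U′≤ : size U′ * suc M ^ suc j ≤ n * M ^ suc j
        U′≤ = geometric-shrink {M} {n} {size U} {size U′} j
                (shrink-step a M (size U′) (outdeg U v) 2a≡1+M
                             (size-remove-N⁺[] {U = U} {v} v∈U) U≤a[1+2o])
                U≤
        shift : ∀ s → GeometricBound a M n (suc j) s → GeometricBound a M n j (suc s)
        shift s (K , s+1+j≤ , bound) = K , subst (_≤ a + K) (+-suc s j) s+1+j≤ , bound

-- Partial sums of exponential and binomial series

^-distribʳ-* : ∀ a b k → (a * b) ^ k ≡ a ^ k * b ^ k
^-distribʳ-* a b zero    = refl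
^-distribʳ-* a b (suc k) =
  trans (cong (a * b *_) (^-distribʳ-* a b k)) (interchange a b (a ^ k) (b ^ k))
  where
  interchange : ∀ a b x y → a * b * (x * y) ≡ a * x * (b * y)
  interchange = solve-∀

rising : ℕ → ℕ → ℕ
rising L zero    = 1
rising L (suc j) = L * rising (suc L) j

rising-pascal : ∀ L j → rising (suc L) (suc j) ≡ rising L (suc j) + suc j * rising (suc L) j
rising-pascal L j = trans (rising-suc (suc L) j) (identity (rising (suc L) j) L j)
  where
  rising-suc : ∀ L j → rising L (suc j) ≡ rising L j * (L + j)
  rising-suc L zero    = trans (*-identityʳ L) (sym (trans (*-identityˡ (L + 0)) (+-identityʳ L)))
  rising-suc L (suc j) = begin
      L * rising (suc L) (suc j)
    ≡⟨ cong (L *_) (rising-suc (suc L) j) ⟩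
      L * (rising (suc L) j * (suc L + j))
    ≡⟨ sym (*-assoc L (rising (suc L) j) (suc L + j)) ⟩
      L * rising (suc L) j * (suc L + j)
    ≡⟨ cong (L * rising (suc L) j *_) (sym (+-suc L j)) ⟩
      L * rising (suc L) j * (L + suc j)
    ∎
    where open ≡-Reasoning
  identity : ∀ x L j → x * (suc L + j) ≡ L * x + suc j * x
  identity = solve-∀

^≤rising : ∀ L j → L ^ j ≤ rising L j
^≤rising L zero    = ≤-refl
^≤rising L (suc j) = *-monoʳ-≤ L (≤-trans (^-monoˡ-≤ j (n≤1+n L)) (^≤rising (suc L) j))

module NegativeBinomialSeries (P : ℕ) where

  -- partialSum L N = N! P^N Σ_{j ≤ N} rising L j / (j! P^j), the N-th partial sum of the
  -- binomial series of (1 - 1/P)^(-L), cleared of denominators.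
  partialSum : ℕ → ℕ → ℕ
  partialSum L zero    = 1
  partialSum L (suc N) = suc N * P * partialSum L N + rising L (suc N)

  partialSum-pascal : ∀ L N →
    partialSum (suc L) (suc N) ≡ partialSum L (suc N) + suc N * partialSum (suc L) N
  partialSum-pascal L zero    = base P L
    where
    base : ∀ P L → 1 * P * 1 + suc L * 1 ≡ (1 * P * 1 + L * 1) + 1 * 1
    base = solve-∀
  partialSum-pascal L (suc N) =
    trans (cong₂ (λ x y → suc (suc N) * P * x + y)
                 (partialSum-pascal L N) (rising-pascal L (suc N)))
          (regroup N P (partialSum L (suc N)) (partialSum (suc L) N)
                       (rising L (suc (suc N))) (rising (suc L) (suc N)))
    where
    regroup : ∀ N P x y z w → (2 + N) * P * (x + (1 + N) * y) + (z + (2 + N) * w)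
                            ≡ ((2 + N) * P * x + z) + (2 + N) * ((1 + N) * P * y + w)
    regroup = solve-∀

  partialSum-zero : ∀ N → partialSum 0 N ≡ N ! * P ^ N
  partialSum-zero zero    = refl
  partialSum-zero (suc N) =
    trans (cong (λ x → suc N * P * x + 0) (partialSum-zero N)) (identity N P (N !) (P ^ N))
    where
    identity : ∀ N P F Q → suc N * P * (F * Q) + 0 ≡ suc N * F * (P * Q)
    identity = solve-∀

  expScaled≤partialSum : ∀ k N → expScaled k N * P ^ N ≤ partialSum (P * k) N
  expScaled≤partialSum k zero    = ≤-refl
  expScaled≤partialSum k (suc N) = begin
      (suc N * expScaled k N + k ^ suc N) * (P * P ^ N)
    ≡⟨ distribute N (expScaled k N) (k ^ suc N) P (P ^ N) ⟩
      suc N * P * (expScaled k N * P ^ N) + k ^ suc N * P ^ suc N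
    ≤⟨ +-mono-≤ (*-monoʳ-≤ (suc N * P) (expScaled≤partialSum k N))
                (≤-reflexive (trans (sym (^-distribʳ-* k P (suc N)))
                                    (cong (_^ suc N) (*-comm k P)))) ⟩
      suc N * P * partialSum (P * k) N + (P * k) ^ suc N
    ≤⟨ +-monoʳ-≤ (suc N * P * partialSum (P * k) N) (^≤rising (P * k) (suc N)) ⟩
      partialSum (P * k) (suc N)
    ∎
    where
    open ≤-Reasoning
    distribute : ∀ N E K P Q → (suc N * E + K) * (P * Q) ≡ suc N * P * (E * Q) + K * (P * Q)
    distribute = solve-∀

module _ (M : ℕ) where
  open NegativeBinomialSeries (suc M)

  -- Σ_j rising L j / (j! (M+1)^j) ≤ (1 - 1/(M+1))^(-L) = ((M+1)/M)^L
  partialSum≤ : ∀ L N → partialSum L N * M ^ L ≤ N ! * suc M ^ (N + L)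
  partialSum≤ zero    N = ≤-reflexive (begin
      partialSum 0 N * 1   ≡⟨ *-identityʳ _ ⟩
      partialSum 0 N       ≡⟨ partialSum-zero N ⟩
      N ! * suc M ^ N      ≡⟨ cong (λ e → N ! * suc M ^ e) (sym (+-identityʳ N)) ⟩
      N ! * suc M ^ (N + 0) ∎)
    where open ≡-Reasoning
  partialSum≤ (suc L) zero    = *-monoʳ-≤ 1 (^-monoˡ-≤ (suc L) (n≤1+n M))
  partialSum≤ (suc L) (suc N) = begin
      partialSum (suc L) (suc N) * M ^ suc L
    ≡⟨ cong (_* M ^ suc L) (partialSum-pascal L N) ⟩
      (partialSum L (suc N) + suc N * partialSum (suc L) N) * (M * M ^ L)
    ≡⟨ distribute (partialSum L (suc N)) N (partialSum (suc L) N) M (M ^ L) ⟩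
      M * (partialSum L (suc N) * M ^ L) + suc N * (partialSum (suc L) N * M ^ suc L)
    ≤⟨ +-mono-≤ (*-monoʳ-≤ M (partialSum≤ L (suc N))) (*-monoʳ-≤ (suc N) (partialSum≤ (suc L) N)) ⟩
      M * (suc N ! * P ^ (suc N + L)) + suc N * (N ! * P ^ (N + suc L))
    ≡⟨ cong (λ e → M * (suc N ! * P ^ e) + suc N * (N ! * P ^ (N + suc L))) (sym (+-suc N L)) ⟩
      M * (suc N ! * P ^ (N + suc L)) + suc N * (N ! * P ^ (N + suc L))
    ≡⟨ collect M N (N !) (P ^ (N + suc L)) ⟩
      suc N ! * P ^ (suc N + suc L)
    ∎
    where
    open ≤-Reasoning
    P = suc M
    distribute : ∀ x N y M Q → (x + suc N * y) * (M * Q) ≡ M * (x * Q) + suc N * (y * (M * Q))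
    distribute = solve-∀
    collect : ∀ M N F Q → M * (suc N * F * Q) + suc N * (F * Q) ≡ suc N * F * (suc M * Q)
    collect = solve-∀

  -- e^k ≤ (1 + 1/M)^((M+1)k)
  exp≤ : ∀ k N → expScaled k N * M ^ (suc M * k) ≤ N ! * suc M ^ (suc M * k)
  exp≤ k N = *-cancelʳ-≤ _ _ (P ^ N) {{m^n≢0 P N}} (begin
      expScaled k N * M ^ L * P ^ N
    ≡⟨ swap (expScaled k N) (M ^ L) (P ^ N) ⟩
      expScaled k N * P ^ N * M ^ L
    ≤⟨ *-monoˡ-≤ (M ^ L) (expScaled≤partialSum k N) ⟩
      partialSum L N * M ^ L
    ≤⟨ partialSum≤ L N ⟩
      N ! * P ^ (N + L)
    ≡⟨ cong (N ! *_) (trans (cong (P ^_) (+-comm N L)) (^-distribˡ-+-* P L N)) ⟩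
      N ! * (P ^ L * P ^ N)
    ≡⟨ sym (*-assoc (N !) (P ^ L) (P ^ N)) ⟩
      N ! * P ^ L * P ^ N
    ∎)
    where
    open ≤-Reasoning
    P = suc M
    L = P * k
    swap : ∀ x y z → x * y * z ≡ x * z * y
    swap = solve-∀

-- e^k ≤ e^K ≤ (1 + 1/M)^((M + 1) K) ≤ (n/a)^(r (M + 1)) = (n/a)^(2 r a)
ExpLe-from-power : ∀ {a M r n k K} → 2 * a ≡ suc M → .{{_ : NonZero M}} → k ≤ K →
                   a ^ r * suc M ^ K ≤ n ^ r * M ^ K → ExpLe k n a (2 * (r * a))
ExpLe-from-power {a} {M} {r} {n} {k} {K} 2a≡1+M k≤K power≤ N =
  *-cancelʳ-≤ _ _ (M ^ L) {{m^n≢0 M L}} (begin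
    expScaled k N * a ^ p * M ^ L
  ≤⟨ *-monoˡ-≤ (M ^ L) (*-monoˡ-≤ (a ^ p) (expScaled-monoˡ k≤K N)) ⟩
    expScaled K N * a ^ p * M ^ L
  ≡⟨ swap (expScaled K N) (a ^ p) (M ^ L) ⟩
    expScaled K N * M ^ L * a ^ p
  ≤⟨ *-monoˡ-≤ (a ^ p) (exp≤ M K N) ⟩
    N ! * P ^ L * a ^ p
  ≡⟨ swap′ (N !) (P ^ L) (a ^ p) ⟩
    N ! * (a ^ p * P ^ L)
  ≤⟨ *-monoʳ-≤ (N !) (subst₂ _≤_ (to-p a P) (to-p n M) (^-monoˡ-≤ P power≤)) ⟩
    N ! * (n ^ p * M ^ L)
  ≡⟨ sym (*-assoc (N !) (n ^ p) (M ^ L)) ⟩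
    N ! * n ^ p * M ^ L
  ∎)
  where
  open ≤-Reasoning
  P = suc M
  L = P * K
  p = 2 * (r * a)
  expScaled-monoˡ : ∀ {k K} → k ≤ K → ∀ N → expScaled k N ≤ expScaled K N
  expScaled-monoˡ k≤K zero    = ≤-refl
  expScaled-monoˡ k≤K (suc N) =
    +-mono-≤ (*-monoʳ-≤ (suc N) (expScaled-monoˡ k≤K N)) (^-monoˡ-≤ (suc N) k≤K)
  r*[2*a] : ∀ r a → r * (2 * a) ≡ 2 * (r * a)
  r*[2*a] = solve-∀
  to-p : ∀ x y → (x ^ r * y ^ K) ^ P ≡ x ^ p * y ^ L
  to-p x y = trans (^-distribʳ-* (x ^ r) (y ^ K) P) (cong₂ _*_
    (trans (^-*-assoc x r P) (cong (x ^_) (trans (cong (r *_) (sym 2a≡1+M)) (r*[2*a] r a))))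
    (trans (^-*-assoc y K P) (cong (y ^_) (*-comm K P))))
  swap : ∀ x y z → x * y * z ≡ x * z * y
  swap = solve-∀
  swap′ : ∀ x y z → x * y * z ≡ x * (z * y)
  swap′ = solve-∀

∣p∣≡size[lookup] : ∀ {n} (p : Sub.Subset n) → Sub.∣ p ∣ ≡ size (lookup p)
∣p∣≡size[lookup] Vec.[]          = refl
∣p∣≡size[lookup] (true  Vec.∷ p) = cong suc (∣p∣≡size[lookup] p)
∣p∣≡size[lookup] (false Vec.∷ p) = ∣p∣≡size[lookup] p

∣tabulate∣ : ∀ {n} (S : FSubset n) → Sub.∣ tabulate S ∣ ≡ size S
∣tabulate∣ S = trans (∣p∣≡size[lookup] (tabulate S)) (size-cong (lookup∘tabulate S))

∈tabulate⁻ : ∀ {n} (S : FSubset n) {u} → u Sub.∈ tabulate S → u ∈ S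
∈tabulate⁻ S {u} u∈ = trans (sym (lookup∘tabulate S u)) ([]=⇒lookup u∈)

∉tabulate⁻ : ∀ {n} (S : FSubset n) {u} → u Sub.∉ tabulate S → u ∉ S
∉tabulate⁻ S {u} u∉ =
  ¬∈⇒∉ {U = S} λ u∈S → u∉ (lookup⇒[]= u (tabulate S) (trans (lookup∘tabulate S u) u∈S))

module _ {n : ℕ} {r : ℕ} (D : Digraph n) where
  open Domination D

  RDominates⇒IsRDom : ∀ {S} → RDominates r ⊤ S → IsRDom r D (tabulate S)
  RDominates⇒IsRDom {S} S-dominates u u∉S =
    subst (r ≤_) (sym ∣S∩inNbr∣) (S-dominates u refl (∉tabulate⁻ S u∉S))
    where
    ∣S∩inNbr∣ : Sub.∣ tabulate S Sub.∩ inNbr D u ∣ ≡ size (S ∩ λ s → D s u)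
    ∣S∩inNbr∣ = trans (∣p∣≡size[lookup] (tabulate S Sub.∩ inNbr D u)) (size-cong λ i →
      trans (lookup-zipWith _∧_ i (tabulate S) (tabulate (λ v → D v u)))
            (cong₂ _∧_ (lookup∘tabulate S i) (lookup∘tabulate (λ v → D v u) i)))

  γ≤size : ∀ {g S} → IsGammaR r D g → RDominates r ⊤ S → g ≤ size S
  γ≤size {S = S} (_ , minimal) S-dominates =
    subst (_ ≤_) (∣tabulate∣ S) (minimal (tabulate S) (RDominates⇒IsRDom S-dominates))

module _ {n : ℕ} (G : Graph n) where

  IsIndepNum⇒IndependenceAtMost : ∀ {a} → IsIndepNum G a → IndependenceAtMost G ⊤ a
  IsIndepNum⇒IndependenceAtMost (_ , maximal) P _ P-independent =
    subst (_≤ _) (∣tabulate∣ P) (maximal (tabulate P) λ u v u∈P v∈P →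
      P-independent u v (∈tabulate⁻ P u∈P) (∈tabulate⁻ P v∈P))

  IsIndepNum⇒≤n : ∀ {a} → IsIndepNum G a → a ≤ n
  IsIndepNum⇒≤n ((S , _ , ∣S∣≡a) , _) = subst (_≤ n) ∣S∣≡a (Sub.∣p∣≤n S)

IsIndepNum⇒1≤ : ∀ {n} (G : Graph (suc n)) {a} → IsIndepNum G a → 1 ≤ a
IsIndepNum⇒1≤ {n} G {a} (_ , maximal) =
  subst (_≤ a) (Sub.∣⁅x⁆∣≡1 (zero {n})) (maximal Sub.⁅ zero ⁆ λ u v u∈ v∈ →
    subst₂ (λ x y → adj G x y ≡ false)
           (sym (Sub.x∈⁅y⁆⇒x≡y zero u∈)) (sym (Sub.x∈⁅y⁆⇒x≡y zero v∈)) (Graph.irrefl G zero))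

Kₙ : ∀ n → Graph n
Kₙ n = record { adj = Kₙ-adj n ; sym = Kₙ-sym ; irrefl = Kₙ-irrefl }
  where
  Kₙ-sym : ∀ u v → Kₙ-adj n u v ≡ Kₙ-adj n v u
  Kₙ-sym u v with u ≟ v | v ≟ u
  ... | yes _   | yes _   = refl
  ... | no  _   | no  _   = refl
  ... | yes u≡v | no  v≢u = contradiction (sym u≡v) v≢u
  ... | no  u≢v | yes v≡u = contradiction (sym v≡u) u≢v
  Kₙ-irrefl : ∀ u → Kₙ-adj n u u ≡ false
  Kₙ-irrefl u with u ≟ u
  ... | yes _ = refl
  ... | no u≢u = contradiction refl u≢u

Kₙ-independence≤1 : ∀ {n} → IndependenceAtMost (Kₙ n) ⊤ 1
Kₙ-independence≤1 {n} P _ P-independent with nonempty? P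
... | no ∄ = subst (_≤ 1) (sym (∄⇒size≡0 {U = P} ∄)) z≤n
... | yes (u , u∈P) = subst (size P ≤_) (size-⁅⁆ u) (size-mono {U = P} P⊆⁅u⁆)
  where
  nonadjacent⇒≡ : ∀ {w} → Kₙ-adj n u w ≡ false → u ≡ w
  nonadjacent⇒≡ {w} u≁w with u ≟ w
  ... | yes u≡w = u≡w
  P⊆⁅u⁆ : P ⊆ ⁅ u ⁆
  P⊆⁅u⁆ w w∈P = subst (_∈ ⁅ u ⁆) (nonadjacent⇒≡ (P-independent u w u∈P w∈P)) (∈⁅⁆ u)

tournament-γ-bound : ∀ r n (D : Digraph n) → IsOrientation (Kₙ-adj n) D →
                     ∀ g → IsGammaR r D g → BoundA r n g
tournament-γ-bound r n D D-orients g γ =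
  let S , _ , S-dominates , 2^S≤ =
        Domination.r-dominate D (λ s → 2 ^ s ≤ suc n) (λ t s → 2 ^ s ≤ suc n ^ t)
                                round (s≤s z≤n) combine r ⊤
  in ≤-trans (^-monoʳ-≤ 2 (γ≤size D γ S-dominates)) 2^S≤
  where
  round : ∀ U → Domination.DominatingSet D U (λ s → 2 ^ s ≤ suc n)
  round U = Domination.weaken D (λ _ 2^s≤ → ≤-trans 2^s≤ (s≤s (size≤n U)))
                                 (dominate-tournament (Kₙ n) D D-orients Kₙ-independence≤1 U)
  combine : ∀ t s₁ s₂ → 2 ^ s₁ ≤ suc n → 2 ^ s₂ ≤ suc n ^ t → 2 ^ (s₁ + s₂) ≤ suc n ^ suc t
  combine t s₁ s₂ 2^s₁≤ 2^s₂≤ = subst (_≤ _) (sym (^-distribˡ-+-* 2 s₁ s₂)) (*-mono-≤ 2^s₁≤ 2^s₂≤)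

γ-excess-bound : ∀ {n r b g} (G : Graph n) → IsIndepNum G (suc b) → (D : Digraph n) →
               IsOrientation (adj G) D → IsGammaR r D g →
               ExpLe (g ∸ r * suc b) n (suc b) (2 * (r * suc b))
γ-excess-bound {n} {r} {b} {g} G α D D-orients γ =
  let S , _ , S-dominates , K , S≤ , power≤ =
        Domination.r-dominate D (GeometricBound a M n 0) (RoundsBound a M n)
          (dominate-geometric G D D-orients 2a≡1+M (IsIndepNum⇒≤n G α)
                                                   (IsIndepNum⇒IndependenceAtMost G α))
          (0 , z≤n , ≤-refl) RoundsBound-suc r ⊤
  in ExpLe-from-power {a} {M} {r} {n} 2a≡1+M
       (m≤n+o⇒m∸n≤o g (r * a) (≤-trans (γ≤size D γ S-dominates) S≤)) power≤
  where
  a = suc b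
  -- M + 1 = 2a, since a greedy step keeps at most a fraction 1 - 1/2a of the residual set
  M = suc (2 * b)
  2a≡1+M : 2 * a ≡ suc M
  2a≡1+M = cong suc (+-suc b (b + 0))

orientation-γ-bound : ∀ r n (G : Graph n) → 1 ≤ n → ∀ a → IsIndepNum G a → (D : Digraph n) →
                      IsOrientation (adj G) D → ∀ g → IsGammaR r D g → BoundB r n a g
orientation-γ-bound r (suc n) G _ a α D D-orients g γ with g ≤? r * a | IsIndepNum⇒1≤ G α
... | yes g≤ra | _     = inj₁ g≤ra
... | no  g≰ra | s≤s _ =
  inj₂ (g ∸ r * a , sym (m+[n∸m]≡n (<⇒≤ (≰⇒> g≰ra))) , γ-excess-bound G α D D-orients γ)

theorem3p1 : (r : ℕ) → 1 ≤ r → (n : ℕ) →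
    ((D : Digraph n) → IsOrientation (Kₙ-adj n) D →
    (g : ℕ) → IsGammaR r D g → BoundA r n g)
    ×
    ((G : Graph n) → 1 ≤ n → (a : ℕ) → IsIndepNum G a →
    (D : Digraph n) → IsOrientation (adj G) D →
    (g : ℕ) → IsGammaR r D g → BoundB r n a g)
theorem3p1 r _ n = tournament-γ-bound r n , orientation-γ-bound r n
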